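{- Let $k\geq 2$ and let $\mathbf{B}$ be a relational structure with universe $\{0,1\}$ all of whose relations are in $k$-IHS-B$+$. Then $\mathbf{B}$ has $(k,k-1+\rho(\mathbf{B}))$-path duality. Similarly, if all relations of $\mathbf{B}$ are in $k$-IHS-B$-$, then $\mathbf{B}$ has $(k,k-1+\rho(\mathbf{B}))$-path duality.
   Context: A vocabulary $\tau$ is a finite set of relation symbols with arities $\rho(R)$; $\rho(\mathbf{B})$ denotes the maximum arity of the relation symbols of $\mathbf{B}$. A $\tau$-structure has a universe and a relation of the right arity for each symbol; structures are finite. A homomorphism is a map between universes preserving all relations. A Boolean relation $R\subseteq\{0,1\}^r$ is in $k$-IHS-B$+$ if it is the set of satisfying assignments of a CNF formula each of whose clauses has the form $\neg v$, $\neg v\vee w$, or $w_1\vee\dots\vee w_k$ (the $w_i$ not necessarily distinct); it is in $k$-IHS-B$-$ if it is expressible by a CNF whose clauses have the form $w$, $\neg v\vee w$, or $\neg v_1\vee\dots\vee\neg v_k$. A path-decomposition of $\mathbf{P}$ is a sequence $S_1,\dots,S_n$ of subsets of its universe such that every relation tuple of $\mathbf{P}$ has all entries in some $S_i$, and if $a\in S_i\cap S_l$, $i\leq l$, then $a\in S_m$ for all $i\leq m\leq l$; $\mathbf{P}$ has pathwidth at most $(j,k')$ if some path-decomposition has $|S_i\cap S_{i+1}|\leq j$ for $i<n$ and $|S_i|\leq k'$ for all $i$. $\mathbf{B}$ has $(j,k')$-path duality if there is a set $\mathcal O$ of finite $\tau$-structures, each of pathwidth at most $(j,k')$, such that for every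 finite $\tau$-structure $\mathbf{A}$: $\mathbf{A}$ is homomorphic to $\mathbf{B}$ iff no $\mathbf{P}\in\mathcal O$ is homomorphic to $\mathbf{A}$. -}

module Defs where

open import Data.Nat using (ℕ; zero; suc; _≤_; _⊔_)
open import Data.Fin using (Fin; zero; suc; toℕ)
open import Data.Fin.Subset using (Subset; _∈_; _∩_; ∣_∣)
open import Data.Vec using (Vec; lookup; map; foldr)
open import Data.Vec.Relation.Unary.All using (All)
open import Data.List using (List)
import Data.List as L
open import Data.Bool using (Bool; true; false; not; _∧_; _∨_)
open import Data.Product using (Σ; _×_; ∃; ∃-syntax; _,_)
open import Relation.Binary.PropositionalEquality using (_≡_)
open import Relation.Nullary using (¬_)
open import Level using () renaming (suc to lsuc)

record Vocab : Set where
  field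
    nsym : ℕ
    ar   : Fin nsym → ℕ
open Vocab public

maxFin : (m : ℕ) → (Fin m → ℕ) → ℕ
maxFin zero    f = 0
maxFin (suc m) f = f zero ⊔ maxFin m (λ i → f (suc i))

ρ : Vocab → ℕ
ρ τ = maxFin (nsym τ) (ar τ)

Str : Vocab → ℕ → Set
Str τ n = (R : Fin (nsym τ)) → Vec (Fin n) (ar τ R) → Bool

Hom : (τ : Vocab) {n m : ℕ} → Str τ n → Str τ m → Set
Hom τ {n} {m} A B =
  Σ (Fin n → Fin m) λ h →
    ∀ (R : Fin (nsym τ)) (t : Vec (Fin n) (ar τ R)) →
      A R t ≡ true → B R (map h t) ≡ true

HasPathwidth≤ : (τ : Vocab) {n : ℕ} → Str τ n → ℕ → ℕ → Set
HasPathwidth≤ τ {n} P j k' =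
  Σ ℕ λ len → Σ (Fin len → Subset n) λ S →
    (∀ (R : Fin (nsym τ)) (t : Vec (Fin n) (ar τ R)) → P R t ≡ true →
       ∃[ i ] All (λ a → a ∈ S i) t)
  × (∀ (a : Fin n) (i l m : Fin len) → toℕ i ≤ toℕ m → toℕ m ≤ toℕ l →
       a ∈ S i → a ∈ S l → a ∈ S m)
  × (∀ (i i' : Fin len) → toℕ i' ≡ suc (toℕ i) → ∣ S i ∩ S i' ∣ ≤ j)
  × (∀ (i : Fin len) → ∣ S i ∣ ≤ k')

HasPathDuality : (τ : Vocab) {m : ℕ} → Str τ m → ℕ → ℕ → Set₁
HasPathDuality τ B j k' =
  Σ ((n : ℕ) → Str τ n → Set) λ 𝒪 →
    (∀ (n : ℕ) (P : Str τ n) → 𝒪 n P → HasPathwidth≤ τ P j k')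
  × (∀ (n : ℕ) (A : Str τ n) →
       (Hom τ A B → ¬ (Σ ℕ λ p → Σ (Str τ p) λ P → 𝒪 p P × Hom τ P A))
     × (¬ (Σ ℕ λ p → Σ (Str τ p) λ P → 𝒪 p P × Hom τ P A) → Hom τ A B))

val : Fin 2 → Bool
val zero       = false
val (suc zero) = true

data ClauseB+ (k r : ℕ) : Set where
  neg  : Fin r → ClauseB+ k r
  imp  : Fin r → Fin r → ClauseB+ k r
  posk : Vec (Fin r) k → ClauseB+ k r

data ClauseB- (k r : ℕ) : Set where
  pos  : Fin r → ClauseB- k r
  imp  : Fin r → Fin r → ClauseB- k r
  negk : Vec (Fin r) k → ClauseB- k r

evalB+ : {k r : ℕ} → Vec (Fin 2) r → ClauseB+ k r → Bool
evalB+ t (neg v)   = not (val (lookup t v))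
evalB+ t (imp v w) = not (val (lookup t v)) ∨ val (lookup t w)
evalB+ t (posk ws) = foldr _ (λ w b → val (lookup t w) ∨ b) false ws

evalB- : {k r : ℕ} → Vec (Fin 2) r → ClauseB- k r → Bool
evalB- t (pos w)   = val (lookup t w)
evalB- t (imp v w) = not (val (lookup t v)) ∨ val (lookup t w)
evalB- t (negk vs) = foldr _ (λ v b → not (val (lookup t v)) ∨ b) false vs

cnfB+ : {k r : ℕ} → List (ClauseB+ k r) → Vec (Fin 2) r → Bool
cnfB+ φ t = L.foldr (λ c b → evalB+ t c ∧ b) true φ

cnfB- : {k r : ℕ} → List (ClauseB- k r) → Vec (Fin 2) r → Bool
cnfB- φ t = L.foldr (λ c b → evalB- t c ∧ b) true φ

InIHSB+ : (k r : ℕ) → (Vec (Fin 2) r → Bool) → Set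
InIHSB+ k r R = Σ (List (ClauseB+ k r)) λ φ → ∀ t → R t ≡ cnfB+ φ t

InIHSB- : (k r : ℕ) → (Vec (Fin 2) r → Bool) → Set
InIHSB- k r R = Σ (List (ClauseB- k r)) λ φ → ∀ t → R t ≡ cnfB- φ t

{-# OPTIONS --safe #-}

-- Unit propagation. Call a vertex of A forced if a chain of tuples of A, linked through clauses
-- ¬ v ∨ w and ending in a clause ¬ v, shows that every homomorphism A → B sends it to 0. Sending
-- the forced vertices to 0 and all others to 1 is a homomorphism, unless some tuple of A meets a
-- clause w₁ ∨ … ∨ w_k in k forced vertices. In that case the root tuple with the k forcing chains
-- glued onto it maps to A but not to B. Laying the chains out one after the other, each bag holds
-- one tuple (at most ρ vertices) and the at most k − 1 root vertices whose chains are still to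
-- come, and consecutive bags share at most k vertices; so the structures of pathwidth at most
-- (k , k − 1 + ρ) that do not map to B form an obstruction set. The k-IHS-B- case is the
-- k-IHS-B+ case with 0 and 1 exchanged.

module Submission where

open import Defs
open import Data.Nat using (ℕ; zero; suc; _≤_; _+_; _∸_; z≤n; s≤s)
open import Data.Nat.Properties
  using (≤-refl; ≤-reflexive; ≤-trans; m≤n⊔m; m≤m⊔n; m≤n+m; +-suc; n≤1+n;
         +-monoʳ-≤; +-monoˡ-≤; ∸-monoˡ-≤; suc-injective; module ≤-Reasoning)
open import Data.Fin using (Fin; zero; suc; toℕ; _↑ˡ_; _↑ʳ_; splitAt; opposite)
open import Data.Fin.Properties
  using (_≟_; any?; ↑ˡ-injective; splitAt-↑ˡ; splitAt-↑ʳ; opposite-involutive)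
open import Data.Fin.Subset using (Subset; inside; outside; ⁅_⁆; _∪_; _∩_; ∣_∣; _⊆_; _⊃_)
  renaming (_∈_ to _∈ₛ_; _∉_ to _∉ₛ_; ⊥ to ∅)
open import Data.Fin.Subset.Properties
  using (_∈?_; p⊆p∪q; x∈p∪q⁺; x∈p∪q⁻; x∈p∩q⁻; x∈⁅x⁆; x∈⁅y⁆⇒x≡y; ∉⊥; ∣⊥∣≡0; ∣⁅x⁆∣≡1;
         p⊆q⇒∣p∣≤∣q∣)
open import Data.Fin.Subset.Induction using (Acc; acc; ⊃-wellFounded)
open import Data.List using (List; []; _∷_; length; _++_)
import Data.List as L
open import Data.List.Properties using (length-map; length-++; length-tabulate)
open import Data.List.Membership.Propositional using (_∈_)
open import Data.List.Membership.Propositional.Properties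
  using (∈-map⁺; ∈-map⁻; ∈-++⁺ˡ; ∈-++⁺ʳ; ∈-++⁻; ∈-tabulate⁺; ∈-tabulate⁻; ∈-allFin)
open import Data.List.Relation.Unary.Any using (here; there)
import Data.List.Relation.Unary.Any as Any
open import Data.List.Relation.Unary.All using (All; []; _∷_)
import Data.List.Relation.Unary.All as All
import Data.List.Relation.Unary.All.Properties as All
open import Data.Vec using (Vec; []; _∷_; lookup; map; tabulate; allFin; toList)
open import Data.Vec.Properties
  using (lookup-map; lookup∘tabulate; tabulate∘lookup; tabulate-∘; tabulate-cong; map-∘; map-cong;
         map-id; lookup-allFin; map-lookup-allFin; length-toList)
import Data.Vec.Properties as Vec
open import Data.Vec.Relation.Unary.All using ([]; _∷_)
import Data.Vec.Relation.Unary.All as VAll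
import Data.Vec.Relation.Unary.All.Properties as VAll
open import Data.Bool using (Bool; true; false; not; _∧_; _∨_; if_then_else_)
open import Data.Bool.Properties
  using (∧-conicalˡ; ∧-conicalʳ; ∨-conicalˡ; ∨-conicalʳ; ∨-comm; not-involutive; ¬-not)
import Data.Bool.Properties as Bool
open import Data.Product using (Σ; _×_; ∃; ∃₂; ∃-syntax; _,_; proj₁; proj₂)
open import Data.Product.Properties using (≡-dec)
open import Data.Sum using (_⊎_; inj₁; inj₂; [_,_]′)
import Data.Sum as Sum
open import Data.Empty using (⊥-elim)
open import Function using (_∘_; id; const)
open import Relation.Binary.PropositionalEquality
  using (_≡_; _≢_; refl; sym; trans; cong; cong₂; subst; module ≡-Reasoning)
open import Relation.Binary.Definitions using (DecidableEquality)
open import Relation.Nullary using (¬_; Dec; yes; no; does; proof; contradiction)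
open import Relation.Nullary.Reflects using (Reflects; invert)
open import Relation.Nullary.Decidable using (map′; _×-dec_; dec-true)
open import Relation.Unary using (Decidable)

ar≤ρ : (τ : Vocab) (R : Fin (nsym τ)) → ar τ R ≤ ρ τ
ar≤ρ τ R = go (nsym τ) (ar τ) R
  where
  go : (m : ℕ) (f : Fin m → ℕ) (i : Fin m) → f i ≤ maxFin m f
  go (suc m) f zero    = m≤m⊔n (f zero) _
  go (suc m) f (suc i) = ≤-trans (go m (f ∘ suc) i) (m≤n⊔m (f zero) _)

↑ˡ≢↑ʳ : ∀ {m n} (i : Fin m) (j : Fin n) → i ↑ˡ n ≢ m ↑ʳ j
↑ˡ≢↑ʳ {m} {n} i j eq
  with trans (sym (splitAt-↑ˡ m i n)) (trans (cong (splitAt m) eq) (splitAt-↑ʳ m n j))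
... | ()

any-Vec? : ∀ {n} r {P : Vec (Fin n) r → Set} → Decidable P → Dec (∃ P)
any-Vec? zero    P? = map′ ([] ,_) (λ { ([] , p) → p }) (P? [])
any-Vec? (suc r) P? = map′ (λ (x , t , p) → x ∷ t , p) (λ { (x ∷ t , p) → x , t , p })
                             (any? λ x → any-Vec? r (P? ∘ (x ∷_)))

toSubset : ∀ {n} → List (Fin n) → Subset n
toSubset []       = ∅
toSubset (x ∷ xs) = ⁅ x ⁆ ∪ toSubset xs

∈-toSubset⁺ : ∀ {n} {x : Fin n} {xs} → x ∈ xs → x ∈ₛ toSubset xs
∈-toSubset⁺ (here refl) = x∈p∪q⁺ (inj₁ (x∈⁅x⁆ _))
∈-toSubset⁺ (there x∈)  = x∈p∪q⁺ (inj₂ (∈-toSubset⁺ x∈))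

∈-toSubset⁻ : ∀ {n} {x : Fin n} xs → x ∈ₛ toSubset xs → x ∈ xs
∈-toSubset⁻ []       x∈ = ⊥-elim (∉⊥ x∈)
∈-toSubset⁻ (y ∷ xs) x∈ with x∈p∪q⁻ ⁅ y ⁆ (toSubset xs) x∈
... | inj₁ x∈y  = here (x∈⁅y⁆⇒x≡y y x∈y)
... | inj₂ x∈xs = there (∈-toSubset⁻ xs x∈xs)

∣p∪q∣≤∣p∣+∣q∣ : ∀ {n} (p q : Subset n) → ∣ p ∪ q ∣ ≤ ∣ p ∣ + ∣ q ∣
∣p∪q∣≤∣p∣+∣q∣ []            []            = z≤n
∣p∪q∣≤∣p∣+∣q∣ (inside ∷ p)  (inside ∷ q)  =
  s≤s (≤-trans (∣p∪q∣≤∣p∣+∣q∣ p q) (+-monoʳ-≤ ∣ p ∣ (n≤1+n _)))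
∣p∪q∣≤∣p∣+∣q∣ (inside ∷ p)  (outside ∷ q) = s≤s (∣p∪q∣≤∣p∣+∣q∣ p q)
∣p∪q∣≤∣p∣+∣q∣ (outside ∷ p) (inside ∷ q)  =
  subst (suc ∣ p ∪ q ∣ ≤_) (sym (+-suc ∣ p ∣ ∣ q ∣)) (s≤s (∣p∪q∣≤∣p∣+∣q∣ p q))
∣p∪q∣≤∣p∣+∣q∣ (outside ∷ p) (outside ∷ q) = ∣p∪q∣≤∣p∣+∣q∣ p q

∣toSubset∣≤length : ∀ {n} (xs : List (Fin n)) → ∣ toSubset xs ∣ ≤ length xs
∣toSubset∣≤length {n} []   = ≤-reflexive (∣⊥∣≡0 n)
∣toSubset∣≤length (x ∷ xs) = ≤-trans (∣p∪q∣≤∣p∣+∣q∣ ⁅ x ⁆ (toSubset xs))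
  (subst (λ c → c + ∣ toSubset xs ∣ ≤ suc (length xs)) (sym (∣⁅x⁆∣≡1 x))
         (s≤s (∣toSubset∣≤length xs)))

∣toSubset∩toSubset∣≤length : ∀ {n} (xs ys zs : List (Fin n)) →
  (∀ {a} → a ∈ xs → a ∈ ys → a ∈ zs) → ∣ toSubset xs ∩ toSubset ys ∣ ≤ length zs
∣toSubset∩toSubset∣≤length xs ys zs shared = ≤-trans (p⊆q⇒∣p∣≤∣q∣ ∩⊆zs) (∣toSubset∣≤length zs)
  where
  ∩⊆zs : toSubset xs ∩ toSubset ys ⊆ toSubset zs
  ∩⊆zs a∈ = let (a∈xs , a∈ys) = x∈p∩q⁻ _ _ a∈ in
            ∈-toSubset⁺ (shared (∈-toSubset⁻ xs a∈xs) (∈-toSubset⁻ ys a∈ys))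

Hom-trans : ∀ {τ n m l} {X : Str τ n} {Y : Str τ m} {W : Str τ l} →
  Hom τ X Y → Hom τ Y W → Hom τ X W
Hom-trans {W = W} (f , f-hom) (g , g-hom) = g ∘ f , λ R t Xt →
  subst (λ s → W R s ≡ true) (sym (map-∘ g f t)) (g-hom R (map f t) (f-hom R t Xt))

hom-or-violation : ∀ {τ n m} (A : Str τ n) (B : Str τ m) (g : Fin n → Fin m) →
  (∀ R t → A R t ≡ true → B R (map g t) ≡ true) ⊎
  ∃₂ λ R t → A R t ≡ true × B R (map g t) ≡ false
hom-or-violation {τ} A B g
  with any? (λ R → any-Vec? (ar τ R) λ t → (A R t Bool.≟ true) ×-dec (B R (map g t) Bool.≟ false))
... | yes (R , t , violation) = inj₂ (R , t , violation)
... | no none = inj₁ λ R t At → ¬-not λ Bt≡false → none (R , t , At , Bt≡false)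

Obstruction : (τ : Vocab) {m : ℕ} → Str τ m → ℕ → ℕ → {n : ℕ} → Str τ n → Set
Obstruction τ B j k' A =
  Σ ℕ λ p → Σ (Str τ p) λ P → (HasPathwidth≤ τ P j k' × ¬ Hom τ P B) × Hom τ P A

pathDuality-from-dichotomy : ∀ {τ m} (B : Str τ m) {j k'} →
  (∀ {n} (A : Str τ n) → Hom τ A B ⊎ Obstruction τ B j k' A) → HasPathDuality τ B j k'
pathDuality-from-dichotomy {τ} B {j} {k'} dichotomy =
  (λ p P → HasPathwidth≤ τ P j k' × ¬ Hom τ P B) , (λ _ _ → proj₁) ,
  λ n A → no-obstruction ,
          [ (λ A→B _ → A→B) , (λ obstruction none → ⊥-elim (none obstruction)) ]′ (dichotomy A)
  where
  no-obstruction : ∀ {n} {A : Str τ n} → Hom τ A B → ¬ Obstruction τ B j k' A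
  no-obstruction {A = A} A→B (_ , P , (_ , ¬P→B) , P→A) =
    ¬P→B (Hom-trans {X = P} {A} {B} P→A A→B)

pathDuality-homEquivalent : ∀ {τ m m'} {B : Str τ m} {B' : Str τ m'} {j k'} →
  Hom τ B B' → Hom τ B' B → HasPathDuality τ B' j k' → HasPathDuality τ B j k'
pathDuality-homEquivalent {B = B} {B'} B→B' B'→B (𝒪 , 𝒪-narrow , duality) =
  𝒪 , 𝒪-narrow , λ n A →
    (λ A→B → proj₁ (duality n A) (Hom-trans {X = A} {B} {B'} A→B B→B')) ,
    (λ none → Hom-trans {X = A} {B'} {B} (proj₂ (duality n A) none) B'→B)

neg-satisfied : ∀ {x} → not (val x) ≡ true → x ≡ zero
neg-satisfied {zero}     _  = refl
neg-satisfied {suc zero} ()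

neg-violated : ∀ {x} → not (val x) ≡ false → x ≡ suc zero
neg-violated {zero}     ()
neg-violated {suc zero} _ = refl

imp-satisfied : ∀ {x y} → not (val x) ∨ val y ≡ true → y ≡ zero → x ≡ zero
imp-satisfied {zero} _ _ = refl
imp-satisfied {suc zero} () refl

imp-violated : ∀ {x y} → not (val x) ∨ val y ≡ false → x ≡ suc zero × y ≡ zero
imp-violated {zero} ()
imp-violated {suc zero} {zero}     _  = refl , refl
imp-violated {suc zero} {suc zero} ()

val≡false : ∀ {x} → val x ≡ false → x ≡ zero
val≡false {zero}     _  = refl
val≡false {suc zero} ()

posk-violated : ∀ {k r} (s : Vec (Fin 2) r) (ws : Vec (Fin r) k) →
  evalB+ s (posk ws) ≡ false → VAll.All (λ w → lookup s w ≡ zero) ws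
posk-violated s []       _  = []
posk-violated s (w ∷ ws) eq = val≡false (∨-conicalˡ _ _ eq) ∷ posk-violated s ws (∨-conicalʳ _ _ eq)

zeros-violate-posk : ∀ {k r} (s : Vec (Fin 2) r) (ws : Vec (Fin r) k) →
  VAll.All (λ w → lookup s w ≡ zero) ws → evalB+ s (posk ws) ≡ false
zeros-violate-posk s []       []       = refl
zeros-violate-posk s (w ∷ ws) (z ∷ zs) = cong₂ _∨_ (cong val z) (zeros-violate-posk s ws zs)

cnfB+-satisfied : ∀ {k r} (φ : List (ClauseB+ k r)) s →
  cnfB+ φ s ≡ true → All (λ c → evalB+ s c ≡ true) φ
cnfB+-satisfied []      s _  = []
cnfB+-satisfied (c ∷ φ) s eq = ∧-conicalˡ _ _ eq ∷ cnfB+-satisfied φ s (∧-conicalʳ _ _ eq)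

cnfB+-violated : ∀ {k r} (φ : List (ClauseB+ k r)) s →
  cnfB+ φ s ≡ false → ∃[ c ] c ∈ φ × evalB+ s c ≡ false
cnfB+-violated []      s ()
cnfB+-violated (c ∷ φ) s eq with evalB+ s c in ev
... | false = c , here refl , ev
... | true  = let (c′ , c′∈ , ev′) = cnfB+-violated φ s eq in c′ , there c′∈ , ev′

zeroOn : ∀ {n} → Subset n → Fin n → Fin 2
zeroOn Z a = if does (a ∈? Z) then zero else suc zero

zeroOn≡zero : ∀ {n} {Z : Subset n} {a} → zeroOn Z a ≡ zero → a ∈ₛ Z
zeroOn≡zero {Z = Z} {a} with a ∈? Z
... | yes a∈Z = const a∈Z

zeroOn≡one : ∀ {n} {Z : Subset n} {a} → zeroOn Z a ≡ suc zero → a ∉ₛ Z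
zeroOn≡one {Z = Z} {a} with a ∈? Z
... | no a∉Z = const a∉Z

-- Gadgets: structures given by a list of tuples, a path decomposition and a homomorphism to A

module Gadgets (τ : Vocab) {nA nB : ℕ} (A : Str τ nA) (B : Str τ nB) (j k' : ℕ) where

  Tuple : ℕ → Set
  Tuple n = Σ (Fin (nsym τ)) λ R → Vec (Fin n) (ar τ R)

  record Gadget (n : ℕ) : Set where
    field
      tuples   : List (Tuple n)
      len      : ℕ
      bag      : Fin (suc len) → List (Fin n)
      covers   : All (λ (_ , t) → ∃[ i ] VAll.All (_∈ bag i) t) tuples
      interval : ∀ {a} i l m → toℕ i ≤ toℕ m → toℕ m ≤ toℕ l →
                 a ∈ bag i → a ∈ bag l → a ∈ bag m
      adjacent : ∀ i i′ → toℕ i′ ≡ suc (toℕ i) →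
                 ∃[ zs ] length zs ≤ j × (∀ {a} → a ∈ bag i → a ∈ bag i′ → a ∈ zs)
      bag-size : ∀ i → length (bag i) ≤ k'
      toA      : Fin n → Fin nA
      toA-hom  : All (λ (R , t) → A R (map toA t) ≡ true) tuples
  open Gadget public

  IsModel : ∀ {n} → Gadget n → (Fin n → Fin nB) → Set
  IsModel G g = All (λ (R , t) → B R (map g t) ≡ true) (tuples G)

  record Extension {n} (G : Gadget n) : Set where
    field
      {size}    : ℕ
      gadget    : Gadget size
      embed     : Fin n → Fin size
      toA-embed : ∀ x → toA gadget (embed x) ≡ toA G x
      restrict  : ∀ g → IsModel gadget g → IsModel G (g ∘ embed)
  open Extension public

  Extension-refl : ∀ {n} {G : Gadget n} → Extension G
  Extension-refl {G = G} = record
    { gadget = G ; embed = id ; toA-embed = λ _ → refl ; restrict = λ _ → id }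

  Extension-trans : ∀ {n} {G : Gadget n} (E : Extension G) → Extension (gadget E) → Extension G
  Extension-trans E F = record
    { gadget    = gadget F
    ; embed     = embed F ∘ embed E
    ; toA-embed = λ x → trans (toA-embed F (embed E x)) (toA-embed E x)
    ; restrict  = λ g → restrict E (g ∘ embed F) ∘ restrict F g
    }

  root : ∀ {R t} → A R t ≡ true → ar τ R ≤ k' → Gadget (ar τ R)
  root {R} {t} At r≤k' = record
    { tuples   = (R , allFin _) ∷ []
    ; len      = 0
    ; bag      = λ _ → L.allFin _
    ; covers   = (zero , VAll.universal ∈-allFin _) ∷ []
    ; interval = λ _ _ _ _ _ a∈ _ → a∈
    ; adjacent = λ { zero zero () }
    ; bag-size = λ _ → subst (_≤ k') (sym (length-tabulate id)) r≤k'
    ; toA      = lookup t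
    ; toA-hom  = subst (λ s → A R s ≡ true) (sym (map-lookup-allFin t)) At ∷ []
    }

  -- Glue a new tuple of A in front of the first bag, sharing only the vertex `link` (at position
  -- p); the vertices `kept` stay in the new first bag. The fresh vertex n ↑ʳ p stays isolated.
  module Glue {n} (G : Gadget n) (link : Fin n) (kept : List (Fin n))
              (front : All (_∈ bag G zero) (link ∷ kept))
              (narrow : suc (length kept) ≤ j) (roomy : length kept + ρ τ ≤ k')
              {R : Fin (nsym τ)} {tA : Vec (Fin nA) (ar τ R)} (tA∈A : A R tA ≡ true)
              (p : Fin (ar τ R)) (link↦p : toA G link ≡ lookup tA p) where

    r : ℕ
    r = ar τ R

    old : Fin n → Fin (n + r)
    old x = x ↑ˡ r

    entry : Fin r → Fin (n + r)
    entry y = if does (y ≟ p) then old link else n ↑ʳ y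

    entry-p : entry p ≡ old link
    entry-p = cong (if_then old link else n ↑ʳ p) (dec-true (p ≟ p) refl)

    toA′ : Fin (n + r) → Fin nA
    toA′ = [ toA G , lookup tA ]′ ∘ splitAt n

    toA′-old : ∀ x → toA′ (old x) ≡ toA G x
    toA′-old x = cong [ toA G , lookup tA ]′ (splitAt-↑ˡ n x r)

    toA′-entry : ∀ y → toA′ (entry y) ≡ lookup tA y
    toA′-entry y with y ≟ p
    ... | yes refl = trans (toA′-old link) link↦p
    ... | no _     = cong [ toA G , lookup tA ]′ (splitAt-↑ʳ n r y)

    old≡entry : ∀ {x} y → old x ≡ entry y → x ≡ link
    old≡entry y eq with y ≟ p
    ... | yes _ = ↑ˡ-injective r _ link eq
    ... | no _  = contradiction eq (↑ˡ≢↑ʳ _ y)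

    ∈-map-old⁻ : ∀ {x xs} → old x ∈ L.map old xs → x ∈ xs
    ∈-map-old⁻ x∈ with ∈-map⁻ old x∈
    ... | y , y∈ , eq = subst (_∈ _) (sym (↑ˡ-injective r _ y eq)) y∈

    new : Vec (Fin (n + r)) r
    new = tabulate entry

    lookup-new : ∀ (g : Fin (n + r) → Fin nB) y → lookup (map g new) y ≡ g (entry y)
    lookup-new g y = trans (lookup-map y g new) (cong g (lookup∘tabulate entry y))

    front-bag : List (Fin (n + r))
    front-bag = L.map old kept ++ L.tabulate entry

    entry∈front : ∀ y → entry y ∈ front-bag
    entry∈front y = ∈-++⁺ʳ _ (∈-tabulate⁺ y)

    kept∈front : All (λ x → old x ∈ front-bag) kept
    kept∈front = All.tabulate (∈-++⁺ˡ ∘ ∈-map⁺ old)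

    front-shared : ∀ {x} → old x ∈ front-bag → x ∈ link ∷ kept
    front-shared x∈ with ∈-++⁻ (L.map old kept) x∈
    ... | inj₁ x∈kept  = there (∈-map-old⁻ x∈kept)
    ... | inj₂ x∈entry = let (y , eq) = ∈-tabulate⁻ x∈entry in here (old≡entry y eq)

    bag′ : Fin (suc (suc (len G))) → List (Fin (n + r))
    bag′ zero    = front-bag
    bag′ (suc i) = L.map old (bag G i)

    interval′ : ∀ {a} i l m → toℕ i ≤ toℕ m → toℕ m ≤ toℕ l →
                a ∈ bag′ i → a ∈ bag′ l → a ∈ bag′ m
    interval′ zero    _       zero    _ _ a∈i _ = a∈i
    interval′ zero    zero    (suc _) _ () _ _
    interval′ zero    (suc l) (suc m) _ (s≤s m≤l) a∈i a∈l with ∈-map⁻ old a∈l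
    ... | x , x∈l , refl =
      ∈-map⁺ old (interval G zero l m z≤n m≤l (All.lookup front (front-shared a∈i)) x∈l)
    interval′ (suc i) _       zero    () _ _ _
    interval′ (suc i) zero    (suc m) _ () _ _
    interval′ (suc i) (suc l) (suc m) (s≤s i≤m) (s≤s m≤l) a∈i a∈l with ∈-map⁻ old a∈i
    ... | x , x∈i , refl = ∈-map⁺ old (interval G i l m i≤m m≤l x∈i (∈-map-old⁻ a∈l))

    adjacent′ : ∀ i i′ → toℕ i′ ≡ suc (toℕ i) →
                ∃[ zs ] length zs ≤ j × (∀ {a} → a ∈ bag′ i → a ∈ bag′ i′ → a ∈ zs)
    adjacent′ zero (suc zero) refl =
      L.map old (link ∷ kept) , subst (_≤ j) (sym (length-map old (link ∷ kept))) narrow , shared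
      where
      shared : ∀ {a} → a ∈ front-bag → a ∈ L.map old (bag G zero) → a ∈ L.map old (link ∷ kept)
      shared a∈front a∈old with ∈-map⁻ old a∈old
      ... | _ , _ , refl = ∈-map⁺ old (front-shared a∈front)
    adjacent′ (suc i) (suc i′) eq with adjacent G i i′ (suc-injective eq)
    ... | zs , zs≤j , shared = L.map old zs , subst (_≤ j) (sym (length-map old zs)) zs≤j , shared′
      where
      shared′ : ∀ {a} → a ∈ L.map old (bag G i) → a ∈ L.map old (bag G i′) → a ∈ L.map old zs
      shared′ a∈i a∈i′ with ∈-map⁻ old a∈i
      ... | _ , x∈i , refl = ∈-map⁺ old (shared x∈i (∈-map-old⁻ a∈i′))

    bag′-size : ∀ i → length (bag′ i) ≤ k'
    bag′-size zero = begin
      length (L.map old kept ++ L.tabulate entry)          ≡⟨ length-++ (L.map old kept) ⟩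
      length (L.map old kept) + length (L.tabulate entry)
        ≡⟨ cong₂ _+_ (length-map old kept) (length-tabulate entry) ⟩
      length kept + r                                      ≤⟨ +-monoʳ-≤ (length kept) (ar≤ρ τ R) ⟩
      length kept + ρ τ                                    ≤⟨ roomy ⟩
      k'                                                   ∎
      where open ≤-Reasoning
    bag′-size (suc i) = subst (_≤ k') (sym (length-map old (bag G i))) (bag-size G i)

    lift : Tuple n → Tuple (n + r)
    lift (S , t) = S , map old t

    map-toA′-new : map toA′ new ≡ tA
    map-toA′-new = begin
      map toA′ (tabulate entry) ≡⟨ tabulate-∘ toA′ entry ⟨
      tabulate (toA′ ∘ entry)   ≡⟨ tabulate-cong toA′-entry ⟩
      tabulate (lookup tA)      ≡⟨ tabulate∘lookup tA ⟩
      tA                        ∎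
      where open ≡-Reasoning

    map-toA′-old : ∀ {l} (t : Vec (Fin n) l) → map toA′ (map old t) ≡ map (toA G) t
    map-toA′-old t = trans (sym (map-∘ toA′ old t)) (map-cong toA′-old t)

    glued : Gadget (n + r)
    glued = record
      { tuples   = (R , new) ∷ L.map lift (tuples G)
      ; len      = suc (len G)
      ; bag      = bag′
      ; covers   = (zero , VAll.tabulate⁺ entry∈front) ∷ All.map⁺ (All.map lift-cover (covers G))
      ; interval = interval′
      ; adjacent = adjacent′
      ; bag-size = bag′-size
      ; toA      = toA′
      ; toA-hom  = subst (λ s → A R s ≡ true) (sym map-toA′-new) tA∈A
                   ∷ All.map⁺ (All.map lift-toA-hom (toA-hom G))
      }
      where
      lift-cover : ∀ {l} {t : Vec (Fin n) l} → ∃[ i ] VAll.All (_∈ bag G i) t →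
                   ∃[ i ] VAll.All (_∈ bag′ i) (map old t)
      lift-cover (i , t⊆i) = suc i , VAll.map⁺ (VAll.map (∈-map⁺ old) t⊆i)

      lift-toA-hom : ∀ {S t} → A S (map (toA G) t) ≡ true → A S (map toA′ (map old t)) ≡ true
      lift-toA-hom {S} {t} = subst (λ s → A S s ≡ true) (sym (map-toA′-old t))

    new-model : ∀ g → IsModel glued g → B R (map g new) ≡ true
    new-model g (Bnew ∷ _) = Bnew

    extension : Extension G
    extension = record
      { gadget    = glued
      ; embed     = old
      ; toA-embed = toA′-old
      ; restrict  = λ g model → All.map (restrict-tuple g) (All.map⁻ (All.tail model))
      }
      where
      restrict-tuple : ∀ g {S t} → B S (map g (map old t)) ≡ true → B S (map (g ∘ old) t) ≡ true
      restrict-tuple g {S} {t} = subst (λ s → B S s ≡ true) (sym (map-∘ g old t))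

  _≟ᵗ_ : ∀ {n} → DecidableEquality (Tuple n)
  _≟ᵗ_ = ≡-dec _≟_ (Vec.≡-dec _≟_)

  structure : ∀ {n} → Gadget n → Str τ n
  structure G R t = does (Any.any? ((R , t) ≟ᵗ_) (tuples G))

  module _ {n} (G : Gadget n) where

    ∈-structure⁻ : ∀ {R t} → structure G R t ≡ true → (R , t) ∈ tuples G
    ∈-structure⁻ {R} {t} eq =
      invert (subst (Reflects _) eq (proof (Any.any? ((R , t) ≟ᵗ_) (tuples G))))

    ∈-structure⁺ : ∀ {R t} → (R , t) ∈ tuples G → structure G R t ≡ true
    ∈-structure⁺ {R} {t} = dec-true (Any.any? ((R , t) ≟ᵗ_) (tuples G))

    pathwidth : HasPathwidth≤ τ (structure G) j k'
    pathwidth = suc (len G) , S , covers′ , interval′ , adjacent′ , bag-size′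
      where
      S : Fin (suc (len G)) → Subset n
      S = toSubset ∘ bag G

      covers′ : ∀ R t → structure G R t ≡ true → ∃[ i ] VAll.All (_∈ₛ S i) t
      covers′ R t Pt =
        let (i , t⊆i) = All.lookup (covers G) (∈-structure⁻ Pt) in i , VAll.map ∈-toSubset⁺ t⊆i

      interval′ : ∀ a i l m → toℕ i ≤ toℕ m → toℕ m ≤ toℕ l → a ∈ₛ S i → a ∈ₛ S l → a ∈ₛ S m
      interval′ a i l m i≤m m≤l a∈i a∈l = ∈-toSubset⁺
        (interval G i l m i≤m m≤l (∈-toSubset⁻ (bag G i) a∈i) (∈-toSubset⁻ (bag G l) a∈l))

      adjacent′ : ∀ i i′ → toℕ i′ ≡ suc (toℕ i) → ∣ S i ∩ S i′ ∣ ≤ j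
      adjacent′ i i′ i′≡1+i =
        let (zs , zs≤j , shared) = adjacent G i i′ i′≡1+i in
        ≤-trans (∣toSubset∩toSubset∣≤length (bag G i) (bag G i′) zs shared) zs≤j

      bag-size′ : ∀ i → ∣ S i ∣ ≤ k'
      bag-size′ i = ≤-trans (∣toSubset∣≤length (bag G i)) (bag-size G i)

    structure→A : Hom τ (structure G) A
    structure→A = toA G , λ R t Pt → All.lookup (toA-hom G) (∈-structure⁻ Pt)

    hom⇒model : Hom τ (structure G) B → ∃ (IsModel G)
    hom⇒model (g , g-hom) = g , All.tabulate λ {(R , t)} t∈ → g-hom R t (∈-structure⁺ t∈)

-- The k-IHS-B+ case

module IHSB+ (k : ℕ) (τ : Vocab) (B : Str τ 2) (B-def : ∀ R → InIHSB+ k (ar τ R) (B R)) where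

  φ : (R : Fin (nsym τ)) → List (ClauseB+ k (ar τ R))
  φ R = proj₁ (B-def R)

  clause-satisfied : ∀ {R s c} → B R s ≡ true → c ∈ φ R → evalB+ s c ≡ true
  clause-satisfied {R} {s} Bs =
    All.lookup (cnfB+-satisfied (φ R) s (trans (sym (proj₂ (B-def R) s)) Bs))

  clause-violated : ∀ {R s} → B R s ≡ false → ∃[ c ] c ∈ φ R × evalB+ s c ≡ false
  clause-violated {R} {s} Bs = cnfB+-violated (φ R) s (trans (sym (proj₂ (B-def R) s)) Bs)

  room : ∀ {l} → suc l ≤ k → l + ρ τ ≤ k ∸ 1 + ρ τ
  room 1+l≤k = +-monoˡ-≤ (ρ τ) (∸-monoˡ-≤ 1 1+l≤k)

  module _ {nA : ℕ} (A : Str τ nA) where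

    open Gadgets τ A B k (k ∸ 1 + ρ τ)

    -- Derivations of "every homomorphism A → B sends a to 0", by unit propagation along the
    -- clauses ¬ v and ¬ v ∨ w.
    data Forced (a : Fin nA) : Set where
      by-neg : ∀ {R t} → A R t ≡ true → ∀ {v} → neg v ∈ φ R → lookup t v ≡ a → Forced a
      by-imp : ∀ {R t} → A R t ≡ true → ∀ {v w} → imp v w ∈ φ R → lookup t v ≡ a →
               Forced (lookup t w) → Forced a

    Conflict : Set
    Conflict = ∃₂ λ R t → A R t ≡ true ×
               ∃[ ws ] posk ws ∈ φ R × VAll.All (λ w → Forced (lookup t w)) ws

    saturate : (Z : Subset nA) → Acc _⊃_ Z → (∀ {a} → a ∈ₛ Z → Forced a) → Hom τ A B ⊎ Conflict
    saturate Z (acc larger) Z-forced =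
      [ (λ hom → inj₁ (zeroOn Z , hom)) , (λ (_ , _ , At , Bt) → repair At (clause-violated Bt)) ]′
        (hom-or-violation A B (zeroOn Z))
      where
      in-Z : ∀ {l} (t : Vec (Fin nA) l) v → lookup (map (zeroOn Z) t) v ≡ zero → lookup t v ∈ₛ Z
      in-Z t v eq = zeroOn≡zero (trans (sym (lookup-map v (zeroOn Z) t)) eq)

      not-in-Z : ∀ {l} (t : Vec (Fin nA) l) v → lookup (map (zeroOn Z) t) v ≡ suc zero →
                 lookup t v ∉ₛ Z
      not-in-Z t v eq = zeroOn≡one (trans (sym (lookup-map v (zeroOn Z) t)) eq)

      grow : ∀ {b} → b ∉ₛ Z → Forced b → Hom τ A B ⊎ Conflict
      grow {b} b∉Z b-forced =
        saturate (Z ∪ ⁅ b ⁆) (larger (p⊆p∪q ⁅ b ⁆ , b , x∈p∪q⁺ (inj₂ (x∈⁅x⁆ b)) , b∉Z)) λ a∈ →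
          [ Z-forced , (λ a∈b → subst Forced (sym (x∈⁅y⁆⇒x≡y b a∈b)) b-forced) ]′ (x∈p∪q⁻ Z ⁅ b ⁆ a∈)

      repair : ∀ {R t} → A R t ≡ true → ∃[ c ] c ∈ φ R × evalB+ (map (zeroOn Z) t) c ≡ false →
               Hom τ A B ⊎ Conflict
      repair {t = t} At (neg v , c∈ , ev) = grow (not-in-Z t v (neg-violated ev)) (by-neg At c∈ refl)
      repair {t = t} At (imp v w , c∈ , ev) =
        let (v-one , w-zero) = imp-violated ev in
        grow (not-in-Z t v v-one) (by-imp At c∈ refl (Z-forced (in-Z t w w-zero)))
      repair {R} {t} At (posk ws , c∈ , ev) =
        inj₂ (R , t , At , ws , c∈ ,
              VAll.map (λ {w} → Z-forced ∘ in-Z t w) (posk-violated (map (zeroOn Z) t) ws ev))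

    Forces : ∀ {n} → Gadget n → Fin n → Set
    Forces G x = ∀ g → IsModel G g → g x ≡ zero

    Forces-embed : ∀ {n} {G : Gadget n} (E : Extension G) {x} →
                   Forces G x → Forces (gadget E) (embed E x)
    Forces-embed E forces g model = forces (g ∘ embed E) (restrict E g model)

    record ForcingExtension {n} (G : Gadget n) (link : Fin n) (kept : List (Fin n)) : Set where
      field
        extension : Extension G
        keeps     : All (λ x → embed extension x ∈ bag (gadget extension) zero) kept
        forces    : Forces (gadget extension) (embed extension link)
    open ForcingExtension

    -- A derivation of `Forced a` is unrolled into a path of tuples of A, one per derivation step.
    chain : ∀ {n a} (G : Gadget n) (link : Fin n) (kept : List (Fin n)) →
            All (_∈ bag G zero) (link ∷ kept) → suc (length kept) ≤ k →
            toA G link ≡ a → Forced a → ForcingExtension G link kept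
    chain G link kept front narrow link↦a (by-neg At {v} v∈ tv≡a) = record
      { extension = S.extension ; keeps = S.kept∈front ; forces = link-forced }
      where
      module S = Glue G link kept front narrow (room narrow) At v (trans link↦a (sym tv≡a))
      link-forced : Forces S.glued (S.old link)
      link-forced g model = begin
        g (S.old link)           ≡⟨ cong g S.entry-p ⟨
        g (S.entry v)            ≡⟨ S.lookup-new g v ⟨
        lookup (map g S.new) v   ≡⟨ neg-satisfied (clause-satisfied (S.new-model g model) v∈) ⟩
        zero                     ∎
        where open ≡-Reasoning
    chain G link kept front narrow link↦a (by-imp At {v} {w} vw∈ tv≡a w-forced) = record
      { extension = Extension-trans S.extension (extension C)
      ; keeps     = All.map⁻ (keeps C)
      ; forces    = link-forced
      }
      where
      module S = Glue G link kept front narrow (room narrow) At v (trans link↦a (sym tv≡a))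
      C : ForcingExtension S.glued (S.entry w) (L.map S.old kept)
      C = chain S.glued (S.entry w) (L.map S.old kept) (S.entry∈front w ∷ All.map⁺ S.kept∈front)
                (subst (λ l → suc l ≤ k) (sym (length-map S.old kept)) narrow)
                (S.toA′-entry w) w-forced
      link-forced : Forces (gadget (extension C)) (embed (extension C) (S.old link))
      link-forced g model = begin
        g′ (S.old link)           ≡⟨ cong g′ S.entry-p ⟨
        g′ (S.entry v)            ≡⟨ S.lookup-new g′ v ⟨
        lookup (map g′ S.new) v   ≡⟨ imp-satisfied (clause-satisfied new-satisfied vw∈) w-zero ⟩
        zero                      ∎
        where
        open ≡-Reasoning
        g′ = g ∘ embed (extension C)
        new-satisfied = S.new-model g′ (restrict (extension C) g model)
        w-zero = trans (S.lookup-new g′ w) (forces C g model)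

    forceAll : ∀ {n l} (G : Gadget n) (ws : Vec (Fin n) l) → l ≤ k →
               VAll.All (_∈ bag G zero) ws → VAll.All (Forced ∘ toA G) ws →
               Σ (Extension G) λ E → VAll.All (Forces (gadget E) ∘ embed E) ws
    forceAll G []       _   _               _                       = Extension-refl , []
    forceAll G (w ∷ ws) l≤k (w∈front ∷ ws∈) (w-forced ∷ ws-forced) =
      Extension-trans E₁ E₂ , Forces-embed E₂ (forces C) ∷ VAll.map⁻ ws-forces
      where
      C : ForcingExtension G w (toList ws)
      C = chain G w (toList ws) (w∈front ∷ VAll.toList⁺ ws∈)
                (subst (λ l → suc l ≤ k) (sym (length-toList ws)) l≤k) refl w-forced
      E₁ = extension C
      rest : Σ (Extension (gadget E₁)) λ E → VAll.All (Forces (gadget E) ∘ embed E) (map (embed E₁) ws)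
      rest = forceAll (gadget E₁) (map (embed E₁) ws) (≤-trans (n≤1+n _) l≤k)
               (VAll.map⁺ (VAll.toList⁻ (keeps C)))
               (VAll.map⁺ (VAll.map (λ {x} → subst Forced (sym (toA-embed E₁ x))) ws-forced))
      E₂ = proj₁ rest
      ws-forces = proj₂ rest

    obstruction : Conflict → Obstruction τ B k (k ∸ 1 + ρ τ) A
    obstruction (R , t , At , ws , ws∈ , ws-forced) =
      _ , structure (gadget E) , (pathwidth (gadget E) , no-model) , structure→A (gadget E)
      where
      G₀ = root At (≤-trans (ar≤ρ τ R) (m≤n+m _ _))
      forcing = forceAll G₀ ws ≤-refl (VAll.universal ∈-allFin ws) ws-forced
      E = proj₁ forcing
      no-model : ¬ Hom τ (structure (gadget E)) B
      no-model hom with hom⇒model (gadget E) hom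
      ... | g , g-model = contradiction (trans (sym root-satisfied) root-violated) λ ()
        where
        s = map (g ∘ embed E) (allFin (ar τ R))
        root-satisfied : evalB+ s (posk ws) ≡ true
        root-satisfied = clause-satisfied (All.head (restrict E g g-model)) ws∈
        ws-zero : ∀ {w} → Forces (gadget E) (embed E w) → lookup s w ≡ zero
        ws-zero {w} forced = begin
          lookup s w                ≡⟨ lookup-map w (g ∘ embed E) (allFin (ar τ R)) ⟩
          g (embed E (lookup (allFin (ar τ R)) w)) ≡⟨ cong (g ∘ embed E) (lookup-allFin w) ⟩
          g (embed E w)             ≡⟨ forced g g-model ⟩
          zero                      ∎
          where open ≡-Reasoning
        root-violated : evalB+ s (posk ws) ≡ false
        root-violated = zeros-violate-posk s ws (VAll.map ws-zero (proj₂ forcing))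

    dichotomy : Hom τ A B ⊎ Obstruction τ B k (k ∸ 1 + ρ τ) A
    dichotomy = Sum.map₂ obstruction (saturate ∅ (⊃-wellFounded ∅) (⊥-elim ∘ ∉⊥))

IHSB+⇒pathDuality : (k : ℕ) (τ : Vocab) (B : Str τ 2) →
  (∀ R → InIHSB+ k (ar τ R) (B R)) → HasPathDuality τ B k (k ∸ 1 + ρ τ)
IHSB+⇒pathDuality k τ B B-def = pathDuality-from-dichotomy B (IHSB+.dichotomy k τ B B-def)

-- The k-IHS-B- case

flipped : ∀ {τ} → Str τ 2 → Str τ 2
flipped B R t = B R (map opposite t)

val-opposite : ∀ x → val (opposite x) ≡ not (val x)
val-opposite zero       = refl
val-opposite (suc zero) = refl

dual : ∀ {k r} → ClauseB- k r → ClauseB+ k r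
dual (pos w)   = neg w
dual (imp v w) = imp w v
dual (negk vs) = posk vs

module _ {r} (s : Vec (Fin 2) r) where

  val-lookup-opposite : ∀ v → val (lookup (map opposite s) v) ≡ not (val (lookup s v))
  val-lookup-opposite v = trans (cong val (lookup-map v opposite s)) (val-opposite (lookup s v))

  evalB+-dual : ∀ {k} (c : ClauseB- k r) → evalB+ s (dual c) ≡ evalB- (map opposite s) c
  evalB+-dual (pos w)   = sym (val-lookup-opposite w)
  evalB+-dual (imp v w) = begin
    not (val (lookup s w)) ∨ val (lookup s v)
      ≡⟨ ∨-comm (not (val (lookup s w))) _ ⟩
    val (lookup s v) ∨ not (val (lookup s w))
      ≡⟨ cong (_∨ not (val (lookup s w))) (not-involutive (val (lookup s v))) ⟨
    not (not (val (lookup s v))) ∨ not (val (lookup s w))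
      ≡⟨ cong₂ _∨_ (cong not (val-lookup-opposite v)) (val-lookup-opposite w) ⟨
    not (val (lookup (map opposite s) v)) ∨ val (lookup (map opposite s) w) ∎
    where open ≡-Reasoning
  evalB+-dual (negk vs) = go vs
    where
    go : ∀ {l} (vs : Vec (Fin r) l) → evalB+ s (posk vs) ≡ evalB- (map opposite s) (negk vs)
    go []       = refl
    go (v ∷ vs) = cong₂ _∨_ (trans (sym (not-involutive _)) (cong not (sym (val-lookup-opposite v))))
                            (go vs)

  cnfB+-dual : ∀ {k} (ψ : List (ClauseB- k r)) → cnfB+ (L.map dual ψ) s ≡ cnfB- ψ (map opposite s)
  cnfB+-dual []      = refl
  cnfB+-dual (c ∷ ψ) = cong₂ _∧_ (evalB+-dual c) (cnfB+-dual ψ)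

IHSB-⇒flipped-IHSB+ : ∀ {k r} {S : Vec (Fin 2) r → Bool} →
  InIHSB- k r S → InIHSB+ k r (S ∘ map opposite)
IHSB-⇒flipped-IHSB+ (ψ , S-def) =
  L.map dual ψ , λ t → trans (S-def (map opposite t)) (sym (cnfB+-dual t ψ))

flipped→B : ∀ {τ} (B : Str τ 2) → Hom τ (flipped B) B
flipped→B B = opposite , λ _ _ Bt → Bt

B→flipped : ∀ {τ} (B : Str τ 2) → Hom τ B (flipped B)
B→flipped B = opposite , λ R t Bt → subst (λ s → B R s ≡ true) (sym (map-opposite² t)) Bt
  where
  map-opposite² : ∀ {r} (t : Vec (Fin 2) r) → map opposite (map opposite t) ≡ t
  map-opposite² t =
    trans (sym (map-∘ opposite opposite t)) (trans (map-cong opposite-involutive t) (map-id t))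

IHSB-⇒pathDuality : (k : ℕ) (τ : Vocab) (B : Str τ 2) →
  (∀ R → InIHSB- k (ar τ R) (B R)) → HasPathDuality τ B k (k ∸ 1 + ρ τ)
IHSB-⇒pathDuality k τ B B-def =
  pathDuality-homEquivalent (B→flipped B) (flipped→B B)
    (IHSB+⇒pathDuality k τ (flipped B) (IHSB-⇒flipped-IHSB+ ∘ B-def))

mainTheorem8 : (k : ℕ) → 2 ≤ k → (τ : Vocab) → (B : Str τ 2) →
    (((∀ (R : Fin (nsym τ)) → InIHSB+ k (ar τ R) (B R)) →
        HasPathDuality τ B k (k ∸ 1 + ρ τ))
    × ((∀ (R : Fin (nsym τ)) → InIHSB- k (ar τ R) (B R)) →
        HasPathDuality τ B k (k ∸ 1 + ρ τ)))
mainTheorem8 k _ τ B = IHSB+⇒pathDuality k τ B , IHSB-⇒pathDuality k τ B
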